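{- Let $\mathfrak F=(X,R,E)$ be a descriptive $\mathbf{MGrz}$-frame and $U\subseteq X$. (1) If $x\in U\cap\mathbf{max}_R E[U]$, then $x\in\mathbf{smax}_R E[U]\cap\mathbf{smax}_R U$. (2) If $U$ is $E$-saturated (i.e., $E[U]=U$), then $\mathbf{smax}_R U=\mathbf{max}_R U$.
   Context: An $\mathbf{MK}$-frame is $(X,R,E)$, $X\neq\varnothing$, $R\subseteq X^2$, $E$ an equivalence relation, with $x\mathrel Ey$, $y\mathrel Rz$ implying $x\mathrel Ru$, $u\mathrel Ez$ for some $u$. A descriptive $\mathbf{MGrz}$-frame is an $\mathbf{MK}$-frame where $X$ is a Stone space (compact Hausdorff zero-dimensional), $R$ and $E$ are continuous (for each $x$, the set of successors is closed, and the set of predecessors of a clopen set is clopen), and the algebra of clopen sets with $\Diamond U=R^{ -1}[U]$ and $\exists U=E[U]$ validates every theorem of $\mathbf{MGrz}$ (the least monadic extension of $\mathbf{Grz}=\mathbf{S4}+\Box(\Box(p\to\Box p)\to p)\to p$ with $\mathbf{S5}$ axioms for $\exists$ and $\exists\Diamond p\to\Diamond\exists p$). For $U\subseteq X$: $E[U]=\{y:u\mathrel Ey$ for some $u\in U\}$; $\mathbf{max}_R U$ is the set of $x\in U$ such that $x\mathrel Ry$ and $y\in U$ imply $y=x$. Let $Q=E\circ R$, i.e., $x\mathrel Qy$ iff $x\mathrel Rz$ and $z\mathrel Ey$ for some $z$. $\mathbf{smax}_R U$ is the set of $x\in\mathbf{max}_R U$ such that for all $y$, $x\mathrel Qy$ and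 $y\in U$ imply $x\mathrel Ey$. -}

module Defs where

open import Level using (0ℓ)
open import Data.Nat using (ℕ)
open import Data.Product using (Σ; _×_; _,_)
open import Data.Sum using (_⊎_)
open import Data.Empty using (⊥)
open import Data.Unit using (⊤)
open import Data.List using (List)
open import Data.List.Relation.Unary.Any using (Any)
open import Relation.Nullary using (¬_)
open import Relation.Binary.Core using (Rel)
open import Relation.Binary.Structures using (IsEquivalence)
open import Relation.Binary.PropositionalEquality using (_≡_)

Sub : Set → Set₁
Sub X = X → Set

module _ {X : Set} where

  _∩_ : Sub X → Sub X → Sub X
  (U ∩ V) x = U x × V x

  _⊆_ : Sub X → Sub X → Set
  U ⊆ V = ∀ x → U x → V x

  _≐_ : Sub X → Sub X → Set
  U ≐ V = (U ⊆ V) × (V ⊆ U)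

  compl : Sub X → Sub X
  compl U x = ¬ U x

  image : Rel X 0ℓ → Sub X → Sub X
  image E U y = Σ X λ u → E u y × U u

  preimage : Rel X 0ℓ → Sub X → Sub X
  preimage R U x = Σ X λ y → R x y × U y

  succs : Rel X 0ℓ → X → Sub X
  succs R x y = R x y

  comp : Rel X 0ℓ → Rel X 0ℓ → Rel X 0ℓ
  comp R E x y = Σ X λ z → R x z × E z y

  maxR : Rel X 0ℓ → Sub X → Sub X
  maxR R U x = U x × (∀ y → R x y → U y → y ≡ x)

  smaxR : Rel X 0ℓ → Rel X 0ℓ → Sub X → Sub X
  smaxR R E U x = maxR R U x × (∀ y → comp R E x y → U y → E x y)

record Topology (X : Set) : Set₁ where
  field
    Open     : Sub X → Set
    open-ext : ∀ {U V} → U ≐ V → Open U → Open V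
    open-X   : Open (λ _ → ⊤)
    open-∩   : ∀ {U V} → Open U → Open V → Open (U ∩ V)
    open-⋃   : (I : Set) (F : I → Sub X) → (∀ i → Open (F i)) →
               Open (λ x → Σ I λ i → F i x)

  Closed : Sub X → Set
  Closed U = Open (compl U)

  Clopen : Sub X → Set
  Clopen U = Open U × Closed U

  Compact : Set₁
  Compact = (I : Set) (F : I → Sub X) → (∀ i → Open (F i)) →
            (∀ x → Σ I λ i → F i x) →
            Σ (List I) λ is → ∀ x → Any (λ i → F i x) is

  Hausdorff : Set₁
  Hausdorff = ∀ x y → ¬ (x ≡ y) →
              Σ (Sub X) λ U → Σ (Sub X) λ V →
              Open U × Open V × U x × V y × (∀ z → U z → V z → ⊥)

  ZeroDimensional : Set₁
  ZeroDimensional = ∀ U → Open U → ∀ x → U x →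
                    Σ (Sub X) λ C → Clopen C × C x × C ⊆ U

  IsStone : Set₁
  IsStone = Compact × Hausdorff × ZeroDimensional

  ContinuousRel : Rel X 0ℓ → Set₁
  ContinuousRel R = (∀ x → Closed (succs R x)) ×
                    (∀ U → Clopen U → Clopen (preimage R U))

infixr 5 _⇒_
infixr 6 _∨_
infixr 7 _∧_

data Fm : Set where
  var  : ℕ → Fm
  ⊥'   : Fm
  _⇒_  : Fm → Fm → Fm
  _∧_  : Fm → Fm → Fm
  _∨_  : Fm → Fm → Fm
  ◇    : Fm → Fm
  ∃'   : Fm → Fm

¬' : Fm → Fm
¬' p = p ⇒ ⊥'

□ : Fm → Fm
□ p = ¬' (◇ (¬' p))

∀' : Fm → Fm
∀' p = ¬' (∃' (¬' p))

-- MGrz: classical propositional logic + S4 + Grz for □, S5 for ∀,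
-- the axiom ∃◇p → ◇∃p, modus ponens and necessitation for □ and ∀.
-- (Axioms are schematic, so the logic is closed under substitution.)
data MGrz⊢ : Fm → Set where
  ax-K     : ∀ {p q} → MGrz⊢ (p ⇒ q ⇒ p)
  ax-S     : ∀ {p q r} → MGrz⊢ ((p ⇒ q ⇒ r) ⇒ (p ⇒ q) ⇒ p ⇒ r)
  ax-∧i    : ∀ {p q} → MGrz⊢ (p ⇒ q ⇒ p ∧ q)
  ax-∧e₁   : ∀ {p q} → MGrz⊢ (p ∧ q ⇒ p)
  ax-∧e₂   : ∀ {p q} → MGrz⊢ (p ∧ q ⇒ q)
  ax-∨i₁   : ∀ {p q} → MGrz⊢ (p ⇒ p ∨ q)
  ax-∨i₂   : ∀ {p q} → MGrz⊢ (q ⇒ p ∨ q)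
  ax-∨e    : ∀ {p q r} → MGrz⊢ ((p ⇒ r) ⇒ (q ⇒ r) ⇒ p ∨ q ⇒ r)
  ax-DNE   : ∀ {p} → MGrz⊢ (¬' (¬' p) ⇒ p)
  ax-□K    : ∀ {p q} → MGrz⊢ (□ (p ⇒ q) ⇒ □ p ⇒ □ q)
  ax-□T    : ∀ {p} → MGrz⊢ (□ p ⇒ p)
  ax-□4    : ∀ {p} → MGrz⊢ (□ p ⇒ □ (□ p))
  ax-Grz   : ∀ {p} → MGrz⊢ (□ (□ (p ⇒ □ p) ⇒ p) ⇒ p)
  ax-∀K    : ∀ {p q} → MGrz⊢ (∀' (p ⇒ q) ⇒ ∀' p ⇒ ∀' q)
  ax-∀T    : ∀ {p} → MGrz⊢ (∀' p ⇒ p)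
  ax-∃5    : ∀ {p} → MGrz⊢ (∃' p ⇒ ∀' (∃' p))
  ax-LC    : ∀ {p} → MGrz⊢ (∃' (◇ p) ⇒ ◇ (∃' p))
  mp       : ∀ {p q} → MGrz⊢ (p ⇒ q) → MGrz⊢ p → MGrz⊢ q
  nec-□    : ∀ {p} → MGrz⊢ p → MGrz⊢ (□ p)
  nec-∀    : ∀ {p} → MGrz⊢ p → MGrz⊢ (∀' p)

⟦_⟧ : ∀ {X : Set} → Fm → Rel X 0ℓ → Rel X 0ℓ → (ℕ → Sub X) → Sub X
⟦ var n ⟧ R E v x = v n x
⟦ ⊥' ⟧    R E v x = ⊥
⟦ p ⇒ q ⟧ R E v x = ⟦ p ⟧ R E v x → ⟦ q ⟧ R E v x
⟦ p ∧ q ⟧ R E v x = ⟦ p ⟧ R E v x × ⟦ q ⟧ R E v x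
⟦ p ∨ q ⟧ R E v x = ⟦ p ⟧ R E v x ⊎ ⟦ q ⟧ R E v x
⟦ ◇ p ⟧   R E v x = preimage R (⟦ p ⟧ R E v) x
⟦ ∃' p ⟧  R E v x = image E (⟦ p ⟧ R E v) x

record DescriptiveMGrzFrame : Set₁ where
  field
    X        : Set
    R        : Rel X 0ℓ
    E        : Rel X 0ℓ
    nonempty : X
    E-equiv  : IsEquivalence E
    MK-comm  : ∀ {x y z} → E x y → R y z → Σ X λ u → R x u × E u z
    τ        : Topology X
    stone    : Topology.IsStone τ
    R-cont   : Topology.ContinuousRel τ R
    E-cont   : Topology.ContinuousRel τ E
    -- the algebra of clopens validates every theorem of MGrz
    validates : ∀ {φ} → MGrz⊢ φ → (v : ℕ → Sub X) →
                (∀ n → Topology.Clopen τ (v n)) → ∀ x → ⟦ φ ⟧ R E v x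

{-# OPTIONS --safe #-}
module Submission where

open import Level using (0ℓ)
open import Defs
open import Data.Product using (_×_; _,_; proj₁)
open import Function.Bundles using (_⇔_; mk⇔)
open import Relation.Binary.Core using (Rel)
open import Relation.Binary.Definitions using (Reflexive; Symmetric; Transitive)
open import Relation.Binary.Structures using (IsEquivalence)
open import Relation.Binary.PropositionalEquality using (refl)

-- If V is E-saturated, x ∈ max_R V and x R z E y with y ∈ V, then z ∈ V, so
-- z = x by maximality and x E y. Thus maximal points of saturated sets are
-- strictly maximal; E[U] is saturated and strict maximality passes to subsets
-- containing the point.

module _ {X : Set} where

  Saturated : Rel X 0ℓ → Sub X → Set
  Saturated E U = image E U ⊆ U

  ⊆-image : ∀ {E} → Reflexive E → (U : Sub X) → U ⊆ image E U
  ⊆-image E-refl U x x∈U = x , E-refl , x∈U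

  image-saturated : ∀ {E} → Transitive E → (U : Sub X) → Saturated E (image E U)
  image-saturated E-trans U y (u , uEy , w , wEu , w∈U) = w , E-trans wEu uEy , w∈U

  maxR⊆smaxR : ∀ {R E} → Symmetric E → {V : Sub X} → Saturated E V →
               maxR R V ⊆ smaxR R E V
  maxR⊆smaxR {R} {E} E-sym {V} sat x x∈max@(_ , isMax) = x∈max , strict
    where
    strict : ∀ y → comp R E x y → V y → E x y
    strict y (z , xRz , zEy) y∈V with isMax z xRz (sat z (y , E-sym zEy , y∈V))
    ... | refl = zEy

  smaxR-antitone : ∀ {R E} {U V : Sub X} → U ⊆ V → (U ∩ smaxR R E V) ⊆ smaxR R E U
  smaxR-antitone U⊆V x (x∈U , (_ , isMax) , strict) =
    (x∈U , λ y xRy y∈U → isMax y xRy (U⊆V y y∈U)) ,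
    (λ y xQy y∈U → strict y xQy (U⊆V y y∈U))

proposition6p15 : (F : DescriptiveMGrzFrame) →
    let open DescriptiveMGrzFrame F in
    (∀ (U : Sub X) x → U x → maxR R (image E U) x →
       smaxR R E (image E U) x × smaxR R E U x)
    ×
    (∀ (U : Sub X) → image E U ≐ U → ∀ x → smaxR R E U x ⇔ maxR R U x)
proposition6p15 F = maximal-in-image , smax-saturated
  where
  open DescriptiveMGrzFrame F
  open IsEquivalence E-equiv renaming (refl to E-refl; sym to E-sym; trans to E-trans)

  maximal-in-image : ∀ (U : Sub X) x → U x → maxR R (image E U) x →
                     smaxR R E (image E U) x × smaxR R E U x
  maximal-in-image U x x∈U x∈max = x∈smax , smaxR-antitone {R = R} (⊆-image E-refl U) x (x∈U , x∈smax)
    where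
    x∈smax : smaxR R E (image E U) x
    x∈smax = maxR⊆smaxR {R = R} E-sym (image-saturated E-trans U) x x∈max

  smax-saturated : ∀ (U : Sub X) → image E U ≐ U → ∀ x → smaxR R E U x ⇔ maxR R U x
  smax-saturated U (sat , _) x = mk⇔ proj₁ (maxR⊆smaxR {R = R} E-sym sat x)
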